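{- $\#\mathrm{FO} = \#\Pi_1$.
   Context: Structures: a finite $\sigma$-structure has universe $\{0,\dots,n-1\}$, $n\ge1$; built-in $\le$ (usual order), $\min=0$, $\mathrm{BIT}(i,j)$ iff the $i$-th bit of $j$ in binary is $1$. $\mathrm{enc}_\sigma(\mathcal{A})$ is the standard binary encoding (non-built-in relations as $0/1$ truth values of all tuples in lexicographic order, non-built-in constants in binary of length $\lceil\log_2 n\rceil$; built-ins not encoded). $\#\mathrm{FO}$: $f:\{0,1\}^*\to\mathbb{N}$ is in $\#\mathrm{FO}$ if there are a vocabulary $\sigma$ containing built-in $\le,\mathrm{BIT},\min$ and a first-order formula $\varphi(F_1,\dots,F_k,x_1,\dots,x_\ell)$ with free function variables $F_i$ of arity $a_i$ (usable in terms) and free individual variables $x_j$ such that for every $\sigma$-structure $\mathcal{A}$, $f(\mathrm{enc}_\sigma(\mathcal{A}))$ is the number of tuples $(f_1,\dots,f_k,c_1,\dots,c_\ell)$ with $f_i:\mathrm{dom}(\mathcal{A})^{a_i}\to\mathrm{dom}(\mathcal{A})$, $c_j\in\mathrm{dom}(\mathcal{A})$ and $\mathcal{A}\models\varphi(\bar f,\bar c)$. $\#\Pi_1$ is defined identically but with $\varphi$ required to be of the form $\forall y_1\cdots\forall y_m\,\psi$ with $\psi$ quantifier-free. -}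

module Defs where

open import Data.Nat using (ℕ; zero; suc; _≤ᵇ_; _≡ᵇ_; _%_; _/_)
open import Data.Nat.Logarithm using (⌈log₂_⌉)
open import Data.Fin using (Fin; toℕ; zero; suc)
open import Data.Bool using (Bool; true; false; not; _∧_; _∨_)
open import Data.List using (List; []; _∷_; map; concatMap; allFin; length; filterᵇ; _++_; concat)
open import Data.Bool.ListAction using (any; all)
open import Data.List.Membership.Propositional using (_∈_)
open import Data.List.Relation.Unary.All as All using (All; []; _∷_)
open import Data.Vec using (Vec; []; _∷_; lookup)
open import Data.Product using (Σ; ∃; _×_; _,_)
open import Function using (_⇔_)
open import Relation.Binary.PropositionalEquality using (_≡_)

testBit : ℕ → ℕ → Bool
testBit k zero    = (k % 2) ≡ᵇ 1
testBit k (suc i) = testBit (k / 2) i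

bits : ℕ → ℕ → List Bool
bits zero    k = []
bits (suc L) k = testBit k L ∷ bits L k

-- Vocabularies and structures
-- A vocabulary lists the arities of its non-built-in relation symbols
-- and the number of its non-built-in constant symbols; the built-ins
-- ≤, BIT, min are always present (they are part of the syntax below).

record Vocab : Set where
  field
    rels   : List ℕ
    nconst : ℕ
open Vocab public

record Struct (σ : Vocab) (n : ℕ) : Set where
  field
    relI : All (λ a → Vec (Fin n) a → Bool) (rels σ)
    conI : Vec (Fin n) (nconst σ)
open Struct public

allTuples : (n a : ℕ) → List (Vec (Fin n) a)
allTuples n zero    = [] ∷ []
allTuples n (suc a) = concatMap (λ i → map (i ∷_) (allTuples n a)) (allFin n)

-- standard binary encoding (built-ins are not encoded)
encRels : ∀ {n} (as : List ℕ) → All (λ a → Vec (Fin n) a → Bool) as → List Bool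
encRels []       []       = []
encRels {n} (a ∷ as) (R ∷ Rs) = map R (allTuples n a) ++ encRels as Rs

encConsts : ∀ {n k} → Vec (Fin n) k → List Bool
encConsts []               = []
encConsts {n} (c ∷ cs) = bits ⌈log₂ n ⌉ (toℕ c) ++ encConsts cs

enc : ∀ {σ n} → Struct σ n → List Bool
enc {σ} A = encRels (rels σ) (relI A) ++ encConsts (conI A)

-- First-order formulas over σ with free function variables of arities
-- fa (usable in terms) and v individual variables in scope (de Bruijn).

data Term (σ : Vocab) (fa : List ℕ) (v : ℕ) : Set where
  var : Fin v → Term σ fa v
  con : Fin (nconst σ) → Term σ fa v
  min : Term σ fa v
  app : ∀ {a} → a ∈ fa → Vec (Term σ fa v) a → Term σ fa v

data Formula (σ : Vocab) (fa : List ℕ) : ℕ → Set where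
  rel  : ∀ {v a} → a ∈ rels σ → Vec (Term σ fa v) a → Formula σ fa v
  eq   : ∀ {v} → Term σ fa v → Term σ fa v → Formula σ fa v
  le   : ∀ {v} → Term σ fa v → Term σ fa v → Formula σ fa v
  bit  : ∀ {v} → Term σ fa v → Term σ fa v → Formula σ fa v
  neg  : ∀ {v} → Formula σ fa v → Formula σ fa v
  and  : ∀ {v} → Formula σ fa v → Formula σ fa v → Formula σ fa v
  or   : ∀ {v} → Formula σ fa v → Formula σ fa v → Formula σ fa v
  ex   : ∀ {v} → Formula σ fa (suc v) → Formula σ fa v
  fall  : ∀ {v} → Formula σ fa (suc v) → Formula σ fa v

data IsQF {σ fa} : ∀ {v} → Formula σ fa v → Set where
  rel : ∀ {v a} (R : a ∈ rels σ) (ts : Vec (Term σ fa v) a) → IsQF (rel R ts)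
  eq  : ∀ {v} (s t : Term σ fa v) → IsQF (eq s t)
  le  : ∀ {v} (s t : Term σ fa v) → IsQF (le s t)
  bit : ∀ {v} (s t : Term σ fa v) → IsQF (bit s t)
  neg : ∀ {v} {φ : Formula σ fa v} → IsQF φ → IsQF (neg φ)
  and : ∀ {v} {φ ψ : Formula σ fa v} → IsQF φ → IsQF ψ → IsQF (and φ ψ)
  or  : ∀ {v} {φ ψ : Formula σ fa v} → IsQF φ → IsQF ψ → IsQF (or φ ψ)

data IsΠ₁ {σ fa} : ∀ {v} → Formula σ fa v → Set where
  qf  : ∀ {v} {ψ : Formula σ fa v} → IsQF ψ → IsΠ₁ ψ
  univ : ∀ {v} {φ : Formula σ fa (suc v)} → IsΠ₁ φ → IsΠ₁ (fall φ)

FunAssign : ℕ → List ℕ → Set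
FunAssign n fa = All (λ a → Vec (Fin n) a → Fin n) fa

-- The universe is {0,…,n-1} with n = suc m ≥ 1; min is interpreted as 0.
module _ {σ : Vocab} {fa : List ℕ} {m : ℕ} (A : Struct σ (suc m)) (F : FunAssign (suc m) fa) where

  mutual
    evalT : ∀ {v} → Vec (Fin (suc m)) v → Term σ fa v → Fin (suc m)
    evalT ρ (var x)    = lookup ρ x
    evalT ρ (con c)    = lookup (conI A) c
    evalT ρ min        = zero
    evalT ρ (app f ts) = All.lookup F f (evalTs ρ ts)

    evalTs : ∀ {v k} → Vec (Fin (suc m)) v → Vec (Term σ fa v) k → Vec (Fin (suc m)) k
    evalTs ρ []       = []
    evalTs ρ (t ∷ ts) = evalT ρ t ∷ evalTs ρ ts

  sat : ∀ {v} → Vec (Fin (suc m)) v → Formula σ fa v → Bool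
  sat ρ (rel R ts) = All.lookup (relI A) R (evalTs ρ ts)
  sat ρ (eq s t)   = toℕ (evalT ρ s) ≡ᵇ toℕ (evalT ρ t)
  sat ρ (le s t)   = toℕ (evalT ρ s) ≤ᵇ toℕ (evalT ρ t)
  -- BIT(i,j): the i-th bit of j is 1
  sat ρ (bit s t)  = testBit (toℕ (evalT ρ t)) (toℕ (evalT ρ s))
  sat ρ (neg φ)    = not (sat ρ φ)
  sat ρ (and φ ψ)  = sat ρ φ ∧ sat ρ ψ
  sat ρ (or φ ψ)   = sat ρ φ ∨ sat ρ ψ
  sat ρ (ex φ)     = any (λ d → sat (d ∷ ρ) φ) (allFin (suc m))
  sat ρ (fall φ)    = all (λ d → sat (d ∷ ρ) φ) (allFin (suc m))

-- Enumerations (each without repetition)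

allFinFuns : ∀ {X : Set} → List X → (k : ℕ) → List (Fin k → X)
allFinFuns xs zero    = (λ ()) ∷ []
allFinFuns xs (suc k) =
  concatMap (λ x → map (λ g → λ { zero → x ; (suc i) → g i }) (allFinFuns xs k)) xs

allFuns : (n a : ℕ) → List (Vec (Fin n) a → Fin n)
allFuns n zero    = map (λ c → λ _ → c) (allFin n)
allFuns n (suc a) = map (λ h → λ { (x ∷ xs) → h x xs }) (allFinFuns (allFuns n a) n)

allFunAssigns : (n : ℕ) (fa : List ℕ) → List (FunAssign n fa)
allFunAssigns n []       = [] ∷ []
allFunAssigns n (a ∷ fa) = concatMap (λ g → map (g ∷_) (allFunAssigns n fa)) (allFuns n a)

count : ∀ {σ fa ℓ m} → Formula σ fa ℓ → Struct σ (suc m) → ℕ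
count {σ} {fa} {ℓ} {m} φ A =
  length (filterᵇ (λ { (F , c) → sat A F c φ })
    (concatMap (λ F → map (F ,_) (allTuples (suc m) ℓ)) (allFunAssigns (suc m) fa)))

#FO : (List Bool → ℕ) → Set
#FO f = Σ Vocab λ σ → Σ (List ℕ) λ fa → Σ ℕ λ ℓ → Σ (Formula σ fa ℓ) λ φ →
  ∀ (m : ℕ) (A : Struct σ (suc m)) → f (enc A) ≡ count φ A

#Π₁ : (List Bool → ℕ) → Set
#Π₁ f = Σ Vocab λ σ → Σ (List ℕ) λ fa → Σ ℕ λ ℓ → Σ (Formula σ fa ℓ) λ φ →
  IsΠ₁ φ × (∀ (m : ℕ) (A : Struct σ (suc m)) → f (enc A) ≡ count φ A)

-- Skolemise every quantifier of φ(F̄, x̄) by a new function variable g(x̄) that is required to be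
-- canonical: the least witness y of ∃y ψ (the least counterexample of ∀y ψ), or 0 if there is
-- none. Canonicity of g is itself a universal, quantifier-free condition, namely for all z
--   (ψ(g x̄) ∨ (g x̄ = 0 ∧ ¬ ψ(z))) ∧ (g x̄ ≤ z ∨ ¬ ψ(z)).
-- So the Skolemised matrix of φ together with these conditions, prenexed, is a Π₁ formula φ′. For
-- every choice of F̄ and x̄, exactly one extension by Skolem functions satisfies φ′ if φ(F̄, x̄)
-- holds, and none if it fails; hence φ and φ′ count the same number of tuples. The inclusion
-- #Π₁ ⊆ #FO is trivial.

module Submission where

open import Defs
open import Algebra.Properties.CommutativeSemigroup using (interchange)
open import Data.Bool using (Bool; true; false; not; _∧_; _∨_; if_then_else_; T; T?)
open import Data.Bool.ListAction as ListAction using (any; all)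
open import Data.Bool.Properties using (∧-identityʳ; ∧-zeroʳ; T-≡; T-not-≡; T-∧; T-∨)
open import Data.Fin using (Fin; toℕ; zero; suc; _↑ˡ_; _<_)
open import Data.Fin.Properties using (suc-injective; <-cmp; toℕ-injective)
open import Data.List using (List; []; _∷_; _++_; map; concatMap; length; filterᵇ; allFin; tabulate)
open import Data.List.Membership.Propositional using (_∈_; lose)
open import Data.List.Membership.Propositional.Properties using (∈-++⁺ˡ; ∈-++⁺ʳ; ∈-allFin)
open import Data.List.Properties using (map-cong)
open import Data.List.Relation.Binary.Subset.Propositional using (_⊆_)
open import Data.List.Relation.Unary.All as All using (All; []; _∷_)
open import Data.List.Relation.Unary.All.Properties using (++⁺; tabulate⁺; all⁺; all⁻)
open import Data.List.Relation.Unary.Any using (here; there; satisfied)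
open import Data.List.Relation.Unary.Any.Properties using (any⁺; any⁻; ++⁻; ++⁺∘++⁻)
open import Data.Nat using (ℕ; zero; suc; _+_; s≤s; _≡ᵇ_; _≤ᵇ_; _≤?_)
open import Data.Nat.Properties
  using (+-identityʳ; +-assoc; +-commutativeSemigroup; ≡ᵇ⇒≡; ≤ᵇ⇒≤; ≤⇒≤ᵇ; <⇒≱; ≰⇒>)
open import Data.Product using (Σ; ∃; _×_; _,_; proj₁; proj₂)
open import Data.Product.Function.NonDependent.Propositional using (_×-⇔_)
open import Data.Sum using (_⊎_; inj₁; inj₂; [_,_]′)
open import Data.Unit using (tt)
open import Data.Vec as Vec using (Vec; []; _∷_)
open import Data.Vec.Functional.Relation.Binary.Pointwise using (Pointwise)
open import Data.Vec.Properties using (lookup-++ˡ; tabulate∘lookup)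
open import Function using (_∘_; _⇔_; mk⇔; Equivalence)
open import Function.Properties.Equivalence using () renaming (trans to ⇔-trans; sym to ⇔-sym)
open import Relation.Binary.Definitions using (tri<; tri≈; tri>)
open import Relation.Binary.PropositionalEquality
  using (_≡_; _≢_; _≗_; refl; sym; trans; cong; cong₂; cong-app; subst; module ≡-Reasoning)
open import Relation.Nullary using (¬_; contradiction; yes; no)
open import Relation.Nullary.Decidable using (decidable-stable)

open Equivalence using (to; from)

private
  variable
    X Y Z : Set

T-not : ∀ {b} → T (not b) ⇔ (¬ T b)
T-not {false} = mk⇔ (λ _ ()) (λ _ → tt)
T-not {true}  = mk⇔ (λ ()) (λ ¬t → ¬t tt)

¬T⇒≡false : ∀ {b} → ¬ T b → b ≡ false
¬T⇒≡false = to T-not-≡ ∘ from T-not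

T⇔T⇒≡ : ∀ {a b} → (T a ⇔ T b) → a ≡ b
T⇔T⇒≡ {false} {false} _   = refl
T⇔T⇒≡ {false} {true}  a⇔b = contradiction (from a⇔b tt) λ ()
T⇔T⇒≡ {true}  {false} a⇔b = contradiction (to a⇔b tt) λ ()
T⇔T⇒≡ {true}  {true}  _   = refl

T-any-allFin : ∀ {n} (P : Fin n → Bool) → T (any P (allFin n)) ⇔ ∃ (T ∘ P)
T-any-allFin {n} P = mk⇔ (satisfied ∘ any⁻ P (allFin n)) λ (i , Pi) → any⁺ P (lose (∈-allFin i) Pi)

T-all-allFin : ∀ {n} (P : Fin n → Bool) → T (all P (allFin n)) ⇔ (∀ i → T (P i))
T-all-allFin {n} P = mk⇔ (λ allP i → All.lookup (all⁺ P (allFin n) allP) (∈-allFin i)) (all⁻ P ∘ tabulate⁺)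

all-∧ˡ : ∀ b (P : X → Bool) x xs → all (λ y → b ∧ P y) (x ∷ xs) ≡ b ∧ all P (x ∷ xs)
all-∧ˡ false P x xs = refl
all-∧ˡ true  P x xs = refl

all-∧ʳ : ∀ (P : X → Bool) b x xs → all (λ y → P y ∧ b) (x ∷ xs) ≡ all P (x ∷ xs) ∧ b
all-∧ʳ P true  x xs = trans (cong ListAction.and (map-cong (∧-identityʳ ∘ P) (x ∷ xs))) (sym (∧-identityʳ _))
all-∧ʳ P false x xs = trans (cong (_∧ _) (∧-zeroʳ (P x))) (sym (∧-zeroʳ _))

indicator : Bool → ℕ
indicator true  = 1
indicator false = 0

sumBy : (X → ℕ) → List X → ℕ
sumBy h []       = 0
sumBy h (x ∷ xs) = h x + sumBy h xs

sumBy-++ : (h : X → ℕ) (xs ys : List X) → sumBy h (xs ++ ys) ≡ sumBy h xs + sumBy h ys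
sumBy-++ h []       ys = refl
sumBy-++ h (x ∷ xs) ys = trans (cong (h x +_) (sumBy-++ h xs ys)) (sym (+-assoc (h x) _ _))

sumBy-map : (h : Y → ℕ) (f : X → Y) (xs : List X) → sumBy h (map f xs) ≡ sumBy (h ∘ f) xs
sumBy-map h f []       = refl
sumBy-map h f (x ∷ xs) = cong (h (f x) +_) (sumBy-map h f xs)

sumBy-concatMap : (h : Y → ℕ) (f : X → List Y) (xs : List X) →
                  sumBy h (concatMap f xs) ≡ sumBy (sumBy h ∘ f) xs
sumBy-concatMap h f []       = refl
sumBy-concatMap h f (x ∷ xs) =
  trans (sumBy-++ h (f x) (concatMap f xs)) (cong (sumBy h (f x) +_) (sumBy-concatMap h f xs))

sumBy-cong : {g h : X → ℕ} → (∀ x → g x ≡ h x) → (xs : List X) → sumBy g xs ≡ sumBy h xs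
sumBy-cong g≗h []       = refl
sumBy-cong g≗h (x ∷ xs) = cong₂ _+_ (g≗h x) (sumBy-cong g≗h xs)

sumBy-zero : {h : X → ℕ} {xs : List X} → All (λ x → h x ≡ 0) xs → sumBy h xs ≡ 0
sumBy-zero []           = refl
sumBy-zero (hx≡0 ∷ h≡0) = cong₂ _+_ hx≡0 (sumBy-zero h≡0)

sumBy-+ : (g h : X → ℕ) (xs : List X) → sumBy (λ x → g x + h x) xs ≡ sumBy g xs + sumBy h xs
sumBy-+ g h []       = refl
sumBy-+ g h (x ∷ xs) =
  trans (cong (g x + h x +_) (sumBy-+ g h xs)) (interchange +-commutativeSemigroup (g x) (h x) _ _)

sumBy-swap : (h : X → Y → ℕ) (xs : List X) (ys : List Y) →
             sumBy (λ x → sumBy (h x) ys) xs ≡ sumBy (λ y → sumBy (λ x → h x y) xs) ys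
sumBy-swap h []       ys = sym (sumBy-zero (All.universal (λ _ → refl) ys))
sumBy-swap h (x ∷ xs) ys =
  trans (cong (sumBy (h x) ys +_) (sumBy-swap h xs ys)) (sym (sumBy-+ (h x) _ ys))

length-filterᵇ : (P : X → Bool) (xs : List X) → length (filterᵇ P xs) ≡ sumBy (indicator ∘ P) xs
length-filterᵇ P []       = refl
length-filterᵇ P (x ∷ xs) with P x
... | true  = cong suc (length-filterᵇ P xs)
... | false = length-filterᵇ P xs

-- The list xs meets the R-class of every t exactly once, in the sense that it
-- sums every weight supported on that class to the value taken there.
record OncePerClass (R : X → X → Set) (xs : List X) : Set where
  constructor oncePerClass
  field
    sumBy-class : (t : X) (k : ℕ) (h : X → ℕ) → (∀ x → R x t → h x ≡ k) → (∀ x → ¬ R x t → h x ≡ 0) →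
                  sumBy h xs ≡ k
open OncePerClass

OncePerClass-[_] : {R : X → X → Set} (x : X) → (∀ t → R x t) → OncePerClass R (x ∷ [])
OncePerClass-[ x ] Rx = oncePerClass λ t k h on off → trans (+-identityʳ (h x)) (on x (Rx t))

sumBy-tabulate-once : ∀ {n} (f : Fin n → X) (h : X → ℕ) (t : Fin n) {k : ℕ} →
                      h (f t) ≡ k → (∀ i → i ≢ t → h (f i) ≡ 0) → sumBy h (tabulate f) ≡ k
sumBy-tabulate-once f h zero    on off =
  trans (cong₂ _+_ on (sumBy-zero (tabulate⁺ (λ i → off (suc i) λ ())))) (+-identityʳ _)
sumBy-tabulate-once f h (suc t) on off =
  trans (cong (_+ sumBy h (tabulate (f ∘ suc))) (off zero λ ()))
        (sumBy-tabulate-once (f ∘ suc) h t on (λ i i≢t → off (suc i) (i≢t ∘ suc-injective)))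

OncePerClass-allFin : ∀ n → OncePerClass _≡_ (allFin n)
OncePerClass-allFin n = oncePerClass λ t k h on off → sumBy-tabulate-once (λ i → i) h t (on t refl) off

OncePerClass-map : {R : X → X → Set} {R′ : Y → Y → Set} {f : X → Y} {xs : List X} (f⁻ : Y → X) →
                   (∀ x t → R′ (f x) t ⇔ R x (f⁻ t)) →
                   OncePerClass R xs → OncePerClass R′ (map f xs)
OncePerClass-map {f = f} {xs} f⁻ R′⇔R once = oncePerClass λ t k h on off →
  trans (sumBy-map h f xs)
        (sumBy-class once (f⁻ t) k (h ∘ f)
          (λ x → on (f x) ∘ from (R′⇔R x t)) (λ x ¬R → off (f x) (¬R ∘ to (R′⇔R x t))))

OncePerClass-pairs : {R₁ : X → X → Set} {R₂ : Y → Y → Set} {R : Z → Z → Set}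
                     {xs : List X} {ys : List Y} {pair : X → Y → Z} (fst : Z → X) (snd : Z → Y) →
                     (∀ x y t → R (pair x y) t ⇔ (R₁ x (fst t) × R₂ y (snd t))) →
                     OncePerClass R₁ xs → OncePerClass R₂ ys →
                     OncePerClass R (concatMap (λ x → map (pair x) ys) xs)
OncePerClass-pairs {R₁ = R₁} {xs = xs} {ys} {pair} fst snd R⇔R₁×R₂ once₁ once₂ =
  oncePerClass λ t k h on off →
    let row-on : ∀ x → R₁ x (fst t) → sumBy (h ∘ pair x) ys ≡ k
        row-on x r₁ = sumBy-class once₂ (snd t) k (h ∘ pair x)
          (λ y r₂ → on (pair x y) (from (R⇔R₁×R₂ x y t) (r₁ , r₂)))
          (λ y ¬r₂ → off (pair x y) (¬r₂ ∘ proj₂ ∘ to (R⇔R₁×R₂ x y t)))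
        row-off : ∀ x → ¬ R₁ x (fst t) → sumBy (h ∘ pair x) ys ≡ 0
        row-off x ¬r₁ = sumBy-zero (All.universal
          (λ y → off (pair x y) (¬r₁ ∘ proj₁ ∘ to (R⇔R₁×R₂ x y t))) ys)
    in begin
      sumBy h (concatMap (λ x → map (pair x) ys) xs)  ≡⟨ sumBy-concatMap h _ xs ⟩
      sumBy (λ x → sumBy h (map (pair x) ys)) xs      ≡⟨ sumBy-cong (λ x → sumBy-map h (pair x) ys) xs ⟩
      sumBy (λ x → sumBy (h ∘ pair x) ys) xs          ≡⟨ sumBy-class once₁ (fst t) k _ row-on row-off ⟩
      k                                               ∎
  where open ≡-Reasoning

OncePerClass-allFinFuns : {R : X → X → Set} {xs : List X} →
                          OncePerClass R xs → ∀ k → OncePerClass (Pointwise R {k}) (allFinFuns xs k)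
OncePerClass-allFinFuns once zero    = OncePerClass-[ (λ ()) ] (λ _ ())
OncePerClass-allFinFuns once (suc k) =
  OncePerClass-pairs (λ t → t zero) (λ t → t ∘ suc)
    (λ x g t → mk⇔ (λ r → r zero , r ∘ suc) λ { (r₀ , r₊) zero → r₀ ; (r₀ , r₊) (suc i) → r₊ i })
    once (OncePerClass-allFinFuns once k)

OncePerClass-allFuns : ∀ n a → OncePerClass (_≗_ {A = Vec (Fin n) a}) (allFuns n a)
OncePerClass-allFuns n zero =
  OncePerClass-map (λ t → t []) (λ c t → mk⇔ (λ r → r []) λ { r [] → r }) (OncePerClass-allFin n)
OncePerClass-allFuns n (suc a) =
  OncePerClass-map (λ t x xs → t (x ∷ xs))
    (λ h t → mk⇔ (λ r x xs → r (x ∷ xs)) λ { r (x ∷ xs) → r x xs })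
    (OncePerClass-allFinFuns (OncePerClass-allFuns n a) n)

RestrictsTo : ∀ {n} {L M : List ℕ} → L ⊆ M → FunAssign n M → FunAssign n L → Set
RestrictsTo {L = L} e F G = ∀ {a} (p : a ∈ L) → All.lookup F (e p) ≗ All.lookup G p

RestrictsTo-∷ : ∀ {n a L M} {e : a ∷ L ⊆ M} (F : FunAssign n M) {g G} →
                RestrictsTo e F (g ∷ G) ⇔ (All.lookup F (e (here refl)) ≗ g × RestrictsTo (e ∘ there) F G)
RestrictsTo-∷ F = mk⇔ (λ r → r (here refl) , λ {b} p → r (there p))
                    λ { (r₀ , r₊) (here refl) → r₀ ; (r₀ , r₊) (there p) → r₊ p }

_≗ₐ_ : ∀ {n L} → FunAssign n L → FunAssign n L → Set
F ≗ₐ G = RestrictsTo (λ p → p) F G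

OncePerClass-allFunAssigns : ∀ n L → OncePerClass (_≗ₐ_ {n} {L}) (allFunAssigns n L)
OncePerClass-allFunAssigns n []      = OncePerClass-[ [] ] (λ _ ())
OncePerClass-allFunAssigns n (a ∷ L) =
  OncePerClass-pairs {pair = _∷_} All.head All.tail ≗ₐ-∷
    (OncePerClass-allFuns n a) (OncePerClass-allFunAssigns n L)
  where
  ≗ₐ-∷ : ∀ g G (F : FunAssign n (a ∷ L)) → (g ∷ G) ≗ₐ F ⇔ (g ≗ All.head F × G ≗ₐ All.tail F)
  ≗ₐ-∷ g G (f ∷ F) = RestrictsTo-∷ {e = λ p → p} (g ∷ G)

lookup-++⁺ˡ : ∀ {P : ℕ → Set} {L M : List ℕ} {a} (G : All P L) (H : All P M) (p : a ∈ L) →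
              All.lookup (++⁺ G H) (∈-++⁺ˡ p) ≡ All.lookup G p
lookup-++⁺ˡ (g ∷ G) H (here refl) = refl
lookup-++⁺ˡ (g ∷ G) H (there p)   = lookup-++⁺ˡ G H p

lookup-++⁺ʳ : ∀ {P : ℕ → Set} {L M : List ℕ} {a} (G : All P L) (H : All P M) (p : a ∈ M) →
              All.lookup (++⁺ G H) (∈-++⁺ʳ L p) ≡ All.lookup H p
lookup-++⁺ʳ []      H p = refl
lookup-++⁺ʳ (g ∷ G) H p = lookup-++⁺ʳ G H p

RestrictsTo-++⁺ : ∀ {n L M N} {e : L ++ M ⊆ N} (F : FunAssign n N) (G : FunAssign n L) (H : FunAssign n M) →
                  RestrictsTo e F (++⁺ G H) ⇔
                  (RestrictsTo (e ∘ ∈-++⁺ˡ) F G × RestrictsTo (e ∘ ∈-++⁺ʳ L) F H)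
RestrictsTo-++⁺ {L = L} {M} {e = e} F G H = mk⇔
  (λ r → (λ {b} p xs → trans (r (∈-++⁺ˡ p) xs) (cong-app (lookup-++⁺ˡ G H p) xs))
        , (λ {b} p xs → trans (r (∈-++⁺ʳ L p) xs) (cong-app (lookup-++⁺ʳ G H p) xs)))
  λ r {b} p → subst (λ p → All.lookup F (e p) ≗ All.lookup (++⁺ G H) p) (++⁺∘++⁻ L p)
                     (split r (++⁻ L p))
  where
  split : RestrictsTo (e ∘ ∈-++⁺ˡ) F G × RestrictsTo (e ∘ ∈-++⁺ʳ L) F H → ∀ {b} (s : b ∈ L ⊎ b ∈ M) →
          let p = [ ∈-++⁺ˡ , ∈-++⁺ʳ L ]′ s in All.lookup F (e p) ≗ All.lookup (++⁺ G H) p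
  split (rˡ , rʳ) (inj₁ q) xs = trans (rˡ q xs) (sym (cong-app (lookup-++⁺ˡ G H q) xs))
  split (rˡ , rʳ) (inj₂ q) xs = trans (rʳ q xs) (sym (cong-app (lookup-++⁺ʳ G H q) xs))

sumBy-allFunAssigns-++ : ∀ n L M (h : FunAssign n (L ++ M) → ℕ) →
  sumBy h (allFunAssigns n (L ++ M)) ≡
  sumBy (λ G → sumBy (λ H → h (++⁺ G H)) (allFunAssigns n M)) (allFunAssigns n L)
sumBy-allFunAssigns-++ n []      M h = sym (+-identityʳ _)
sumBy-allFunAssigns-++ n (a ∷ L) M h =
  begin
    sumBy h (allFunAssigns n (a ∷ L ++ M))
  ≡⟨ sumBy-concatMap h _ (allFuns n a) ⟩
    sumBy (λ g → sumBy h (map (g ∷_) (allFunAssigns n (L ++ M)))) (allFuns n a)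
  ≡⟨ sumBy-cong (λ g → trans (sumBy-map h (g ∷_) (allFunAssigns n (L ++ M)))
                              (sumBy-allFunAssigns-++ n L M (h ∘ (g ∷_))))
                (allFuns n a) ⟩
    sumBy (λ g → sumBy (λ G → sumBy (λ H → h (g ∷ ++⁺ G H)) (allFunAssigns n M)) (allFunAssigns n L))
          (allFuns n a)
  ≡⟨ sym (sumBy-cong (λ g → sumBy-map _ (g ∷_) (allFunAssigns n L)) (allFuns n a)) ⟩
    sumBy (λ g → sumBy (λ G → sumBy (λ H → h (++⁺ G H)) (allFunAssigns n M)) (map (g ∷_) (allFunAssigns n L)))
          (allFuns n a)
  ≡⟨ sym (sumBy-concatMap _ _ (allFuns n a)) ⟩
    sumBy (λ G → sumBy (λ H → h (++⁺ G H)) (allFunAssigns n M)) (allFunAssigns n (a ∷ L))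
  ∎
  where open ≡-Reasoning

count-as-sumBy : ∀ {σ fa ℓ m} (φ : Formula σ fa ℓ) (A : Struct σ (suc m)) →
  count φ A ≡ sumBy (λ F → sumBy (λ c → indicator (sat A F c φ)) (allTuples (suc m) ℓ))
                    (allFunAssigns (suc m) fa)
count-as-sumBy {fa = fa} {ℓ} {m} φ A =
  trans (length-filterᵇ (λ { (F , c) → sat A F c φ }) (concatMap (λ F → map (F ,_) tuples) assigns))
  (trans (sumBy-concatMap _ (λ F → map (F ,_) tuples) assigns)
         (sumBy-cong (λ F → sumBy-map _ (F ,_) tuples) assigns))
  where
  tuples = allTuples (suc m) ℓ
  assigns = allFunAssigns (suc m) fa

leastWitness : ∀ {k} → (Fin (suc k) → Bool) → Fin (suc k)
leastWitness {zero}  P = zero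
leastWitness {suc k} P =
  if P zero then zero else (if P (suc j) then suc j else zero)
  where j = leastWitness (P ∘ suc)

IsLeastWitness : ∀ {k} → (Fin (suc k) → Bool) → Fin (suc k) → Set
IsLeastWitness P g = (T (P g) × (∀ z → z < g → ¬ T (P z))) ⊎ (g ≡ zero × (∀ z → ¬ T (P z)))

leastWitness-isLeast : ∀ {k} (P : Fin (suc k) → Bool) → IsLeastWitness P (leastWitness P)
leastWitness-isLeast {zero} P with P zero in P0
... | true  = inj₁ (tt , λ _ ())
... | false = inj₂ (refl , λ { zero → subst T P0 })
leastWitness-isLeast {suc k} P with P zero in P0
... | true  = inj₁ (subst T (sym P0) tt , λ _ ())
... | false with leastWitness-isLeast (P ∘ suc)
...   | inj₁ (Pj , least) rewrite to T-≡ Pj =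
  inj₁ (Pj , λ { zero _ → subst T P0 ; (suc z) (s≤s z<j) → least z z<j })
...   | inj₂ (_ , none) rewrite ¬T⇒≡false (none (leastWitness (P ∘ suc))) =
  inj₂ (refl , λ { zero → subst T P0 ; (suc z) → none z })

isLeastWitness-unique : ∀ {k} {P : Fin (suc k) → Bool} {g g′} →
                        IsLeastWitness P g → IsLeastWitness P g′ → g ≡ g′
isLeastWitness-unique {g = g} {g′} (inj₁ (Pg , least)) (inj₁ (Pg′ , least′)) with <-cmp g g′
... | tri< g<g′ _ _ = contradiction Pg (least′ g g<g′)
... | tri≈ _ g≡g′ _ = g≡g′
... | tri> _ _ g′<g = contradiction Pg′ (least g′ g′<g)
isLeastWitness-unique {g = g}  (inj₁ (Pg , _))    (inj₂ (_ , none))   = contradiction Pg (none g)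
isLeastWitness-unique {g′ = g′} (inj₂ (_ , none))  (inj₁ (Pg′ , _))   = contradiction Pg′ (none g′)
isLeastWitness-unique (inj₂ (g≡0 , _)) (inj₂ (g′≡0 , _)) = trans g≡0 (sym g′≡0)

isLeastWitness⇔≡leastWitness : ∀ {k} (P : Fin (suc k) → Bool) g → IsLeastWitness P g ⇔ g ≡ leastWitness P
isLeastWitness⇔≡leastWitness P g =
  mk⇔ (λ least → isLeastWitness-unique least (leastWitness-isLeast P)) λ { refl → leastWitness-isLeast P }

leastWitness-cong : ∀ {k} {P Q : Fin (suc k) → Bool} → (∀ y → P y ≡ Q y) → leastWitness P ≡ leastWitness Q
leastWitness-cong {zero}          P≗Q = refl
leastWitness-cong {suc k} {P} {Q} P≗Q
  rewrite P≗Q zero | leastWitness-cong (P≗Q ∘ suc) | P≗Q (suc (leastWitness (Q ∘ suc))) = refl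

-- Imposed for every z, this forces g to be the least witness of P, or zero if there is none.
witnessCondition : ∀ {k} → Fin (suc k) → (Fin (suc k) → Bool) → Fin (suc k) → Bool
witnessCondition g P z = (P g ∨ ((toℕ g ≡ᵇ 0) ∧ not (P z))) ∧ ((toℕ g ≤ᵇ toℕ z) ∨ not (P z))

witnessCondition-isLeast : ∀ {k} (P : Fin (suc k) → Bool) g →
                           (∀ z → T (witnessCondition g P z)) ⇔ IsLeastWitness P g
witnessCondition-isLeast P g = mk⇔ forward backward
  where
  forward : (∀ z → T (witnessCondition g P z)) → IsLeastWitness P g
  forward cond with T? (P g)
  ... | yes Pg = inj₁ (Pg , λ z z<g →
          [ (λ g≤z _ → <⇒≱ z<g (≤ᵇ⇒≤ (toℕ g) (toℕ z) g≤z)) , to T-not ]′ (to T-∨ (proj₂ (to T-∧ (cond z)))))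
  ... | no ¬Pg = inj₂ (g≡0 (proj₁ (noWitness zero)) , λ z → proj₂ (noWitness z))
    where
    noWitness : ∀ z → T (toℕ g ≡ᵇ 0) × ¬ T (P z)
    noWitness z with to T-∨ (proj₁ (to T-∧ (cond z)))
    ... | inj₁ Pg = contradiction Pg ¬Pg
    ... | inj₂ r  = let (g≡ᵇ0 , notPz) = to T-∧ r in g≡ᵇ0 , to T-not notPz
    g≡0 : T (toℕ g ≡ᵇ 0) → g ≡ zero
    g≡0 g≡ᵇ0 = toℕ-injective (≡ᵇ⇒≡ (toℕ g) 0 g≡ᵇ0)
  backward : IsLeastWitness P g → ∀ z → T (witnessCondition g P z)
  backward (inj₁ (Pg , least)) z with toℕ g ≤? toℕ z
  ... | yes g≤z = from T-∧ (from T-∨ (inj₁ Pg) , from T-∨ (inj₁ (≤⇒≤ᵇ g≤z)))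
  ... | no  g≰z = from T-∧ (from T-∨ (inj₁ Pg) , from T-∨ (inj₂ (from T-not (least z (≰⇒> g≰z)))))
  backward (inj₂ (refl , none)) z =
    from (T-∧ {y = true}) (from T-∨ (inj₂ (from T-∧ (tt , from T-not (none z)))) , tt)

leastWitness-any : ∀ {k} (P : Fin (suc k) → Bool) → P (leastWitness P) ≡ any P (allFin (suc k))
leastWitness-any P = T⇔T⇒≡ (mk⇔ (λ Pg → from (T-any-allFin P) (_ , Pg)) someWitness)
  where
  someWitness : T (any P (allFin _)) → T (P (leastWitness P))
  someWitness anyP with to (T-any-allFin P) anyP | leastWitness-isLeast P
  ... | _ , _  | inj₁ (Pg , _)    = Pg
  ... | i , Pi | inj₂ (_ , none) = contradiction Pi (none i)

leastWitness-all : ∀ {k} (P : Fin (suc k) → Bool) → P (leastWitness (not ∘ P)) ≡ all P (allFin (suc k))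
leastWitness-all P =
  T⇔T⇒≡ (mk⇔ (from (T-all-allFin P) ∘ noCounterexample) (λ allP → to (T-all-allFin P) allP _))
  where
  noCounterexample : T (P (leastWitness (not ∘ P))) → ∀ i → T (P i)
  noCounterexample Pg i = decidable-stable (T? (P i)) λ ¬Pi →
    [ (λ (notPg , _) → to T-not notPg Pg) , (λ (_ , none) → none i (from T-not ¬Pi)) ]′
      (leastWitness-isLeast (not ∘ P))

Env : ℕ → ℕ → Set
Env m = Vec (Fin (suc m))

module _ {σ : Vocab} {fa : List ℕ} where

  Subst : ℕ → ℕ → Set
  Subst v w = Fin v → Term σ fa w

  mutual
    substTerm : ∀ {v w} → Subst v w → Term σ fa v → Term σ fa w
    substTerm s (var x)    = s x
    substTerm s (con c)    = con c
    substTerm s min        = min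
    substTerm s (app f ts) = app f (substTerms s ts)

    substTerms : ∀ {v w k} → Subst v w → Vec (Term σ fa v) k → Vec (Term σ fa w) k
    substTerms s []       = []
    substTerms s (t ∷ ts) = substTerm s t ∷ substTerms s ts

  liftSubst : ∀ {v w} → Subst v w → Subst (suc v) (suc w)
  liftSubst s zero    = var zero
  liftSubst s (suc i) = substTerm (var ∘ suc) (s i)

  substFormula : ∀ {v w} → Subst v w → Formula σ fa v → Formula σ fa w
  substFormula s (rel R ts) = rel R (substTerms s ts)
  substFormula s (eq t u)   = eq (substTerm s t) (substTerm s u)
  substFormula s (le t u)   = le (substTerm s t) (substTerm s u)
  substFormula s (bit t u)  = bit (substTerm s t) (substTerm s u)
  substFormula s (neg φ)    = neg (substFormula s φ)
  substFormula s (and φ ψ)  = and (substFormula s φ) (substFormula s ψ)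
  substFormula s (or φ ψ)   = or (substFormula s φ) (substFormula s ψ)
  substFormula s (ex φ)     = ex (substFormula (liftSubst s) φ)
  substFormula s (fall φ)   = fall (substFormula (liftSubst s) φ)

  substFormula-isQF : ∀ {v w} (s : Subst v w) {φ} → IsQF φ → IsQF (substFormula s φ)
  substFormula-isQF s (rel R ts) = rel R _
  substFormula-isQF s (eq t u)   = eq _ _
  substFormula-isQF s (le t u)   = le _ _
  substFormula-isQF s (bit t u)  = bit _ _
  substFormula-isQF s (neg q)    = neg (substFormula-isQF s q)
  substFormula-isQF s (and q r)  = and (substFormula-isQF s q) (substFormula-isQF s r)
  substFormula-isQF s (or q r)   = or (substFormula-isQF s q) (substFormula-isQF s r)

  substFormula-isΠ₁ : ∀ {v w} (s : Subst v w) {φ} → IsΠ₁ φ → IsΠ₁ (substFormula s φ)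
  substFormula-isΠ₁ s (qf q)   = qf (substFormula-isQF s q)
  substFormula-isΠ₁ s (univ p) = univ (substFormula-isΠ₁ (liftSubst s) p)

  weaken : ∀ {w} → Formula σ fa w → Formula σ fa (suc w)
  weaken = substFormula (var ∘ suc)

  foralls : ∀ k {w} → Formula σ fa (k + w) → Formula σ fa w
  foralls zero    φ = φ
  foralls (suc k) φ = foralls k (fall φ)

  foralls-isΠ₁ : ∀ k {w} {φ : Formula σ fa (k + w)} → IsΠ₁ φ → IsΠ₁ (foralls k φ)
  foralls-isΠ₁ zero    p = p
  foralls-isΠ₁ (suc k) p = foralls-isΠ₁ k (univ p)

  closure : ∀ {k w} → Formula σ fa k → Formula σ fa w
  closure {k} {w} φ = foralls k (substFormula (λ i → var (i ↑ˡ w)) φ)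

  closure-isΠ₁ : ∀ {k w} {φ : Formula σ fa k} → IsΠ₁ φ → IsΠ₁ (closure {w = w} φ)
  closure-isΠ₁ {k} p = foralls-isΠ₁ k (substFormula-isΠ₁ _ p)

  Π₁Formula : ℕ → Set
  Π₁Formula w = Σ (Formula σ fa w) IsΠ₁

  univΠ₁ : ∀ {w} → Π₁Formula (suc w) → Π₁Formula w
  univΠ₁ (φ , p) = fall φ , univ p

  -- Prenex form of a conjunction; sat-conj relies on the universe being nonempty.
  conjQF : ∀ {w} {φ ψ : Formula σ fa w} → IsQF φ → IsΠ₁ ψ → Π₁Formula w
  conjQF {φ = φ} {ψ} p (qf q)   = and φ ψ , qf (and p q)
  conjQF             p (univ q) = univΠ₁ (conjQF (substFormula-isQF (var ∘ suc) p) q)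

  conj : ∀ {w} {φ ψ : Formula σ fa w} → IsΠ₁ φ → IsΠ₁ ψ → Π₁Formula w
  conj (qf p)   q = conjQF p q
  conj (univ p) q = univΠ₁ (conj p (substFormula-isΠ₁ (var ∘ suc) q))

  infixr 6 _∧Π₁_
  _∧Π₁_ : ∀ {w} → Π₁Formula w → Π₁Formula w → Π₁Formula w
  (_ , p) ∧Π₁ (_ , q) = conj p q

  module _ {m} (A : Struct σ (suc m)) (F : FunAssign (suc m) fa) where

    _⊨_∶_ : ∀ {v w} → Env m w → Subst v w → Env m v → Set
    ρ′ ⊨ s ∶ ρ = ∀ i → evalT A F ρ′ (s i) ≡ Vec.lookup ρ i

    mutual
      evalT-substTerm : ∀ {v w} {s : Subst v w} {ρ′ ρ} → ρ′ ⊨ s ∶ ρ → ∀ t →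
                        evalT A F ρ′ (substTerm s t) ≡ evalT A F ρ t
      evalT-substTerm s∶ρ (var x)    = s∶ρ x
      evalT-substTerm s∶ρ (con c)    = refl
      evalT-substTerm s∶ρ min        = refl
      evalT-substTerm s∶ρ (app f ts) = cong (All.lookup F f) (evalTs-substTerms s∶ρ ts)

      evalTs-substTerms : ∀ {v w k} {s : Subst v w} {ρ′ ρ} → ρ′ ⊨ s ∶ ρ → (ts : Vec (Term σ fa v) k) →
                          evalTs A F ρ′ (substTerms s ts) ≡ evalTs A F ρ ts
      evalTs-substTerms s∶ρ []       = refl
      evalTs-substTerms s∶ρ (t ∷ ts) = cong₂ _∷_ (evalT-substTerm s∶ρ t) (evalTs-substTerms s∶ρ ts)

    evalTs-tabulate : ∀ {v k} (ρ : Env m v) (f : Fin k → Term σ fa v) →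
                      evalTs A F ρ (Vec.tabulate f) ≡ Vec.tabulate (evalT A F ρ ∘ f)
    evalTs-tabulate {k = zero}  ρ f = refl
    evalTs-tabulate {k = suc k} ρ f = cong (evalT A F ρ (f zero) ∷_) (evalTs-tabulate ρ (f ∘ suc))

    liftSubst-⊨ : ∀ {v w} {s : Subst v w} {ρ′ ρ} d → ρ′ ⊨ s ∶ ρ → (d ∷ ρ′) ⊨ liftSubst s ∶ (d ∷ ρ)
    liftSubst-⊨ d s∶ρ zero    = refl
    liftSubst-⊨ {s = s} {ρ′} d s∶ρ (suc i) = trans (evalT-substTerm {ρ = ρ′} (λ _ → refl) (s i)) (s∶ρ i)

    sat-substFormula : ∀ {v w} {s : Subst v w} {ρ′ ρ} → ρ′ ⊨ s ∶ ρ → ∀ φ →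
                       sat A F ρ′ (substFormula s φ) ≡ sat A F ρ φ
    sat-substFormula s∶ρ (rel R ts) = cong (All.lookup (relI A) R) (evalTs-substTerms s∶ρ ts)
    sat-substFormula s∶ρ (eq t u)   =
      cong₂ (λ x y → toℕ x ≡ᵇ toℕ y) (evalT-substTerm s∶ρ t) (evalT-substTerm s∶ρ u)
    sat-substFormula s∶ρ (le t u)   =
      cong₂ (λ x y → toℕ x ≤ᵇ toℕ y) (evalT-substTerm s∶ρ t) (evalT-substTerm s∶ρ u)
    sat-substFormula s∶ρ (bit t u)  =
      cong₂ (λ x y → testBit (toℕ y) (toℕ x)) (evalT-substTerm s∶ρ t) (evalT-substTerm s∶ρ u)
    sat-substFormula s∶ρ (neg φ)    = cong not (sat-substFormula s∶ρ φ)
    sat-substFormula s∶ρ (and φ ψ)  = cong₂ _∧_ (sat-substFormula s∶ρ φ) (sat-substFormula s∶ρ ψ)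
    sat-substFormula s∶ρ (or φ ψ)   = cong₂ _∨_ (sat-substFormula s∶ρ φ) (sat-substFormula s∶ρ ψ)
    sat-substFormula s∶ρ (ex φ)     =
      cong ListAction.or (map-cong (λ d → sat-substFormula (liftSubst-⊨ d s∶ρ) φ) (allFin (suc m)))
    sat-substFormula s∶ρ (fall φ)   =
      cong ListAction.and (map-cong (λ d → sat-substFormula (liftSubst-⊨ d s∶ρ) φ) (allFin (suc m)))

    sat-weaken : ∀ {w} d (ρ : Env m w) φ → sat A F (d ∷ ρ) (weaken φ) ≡ sat A F ρ φ
    sat-weaken d ρ = sat-substFormula {ρ = ρ} (λ _ → refl)

    T-sat-foralls : ∀ k {w} (φ : Formula σ fa (k + w)) (ρ : Env m w) →
                    T (sat A F ρ (foralls k φ)) ⇔ (∀ ys → T (sat A F (ys Vec.++ ρ) φ))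
    T-sat-foralls zero    φ ρ = mk⇔ (λ { satφ [] → satφ }) (λ satφ → satφ [])
    T-sat-foralls (suc k) φ ρ = mk⇔
      (λ { sat∀ (y ∷ ys) → to (T-all-allFin _) (to (T-sat-foralls k (fall φ) ρ) sat∀ ys) y })
      (λ sat∀ → from (T-sat-foralls k (fall φ) ρ) λ ys → from (T-all-allFin _) λ y → sat∀ (y ∷ ys))

    T-sat-closure : ∀ {k w} (φ : Formula σ fa k) (ρ : Env m w) →
                    T (sat A F ρ (closure φ)) ⇔ (∀ ys → T (sat A F ys φ))
    T-sat-closure {k} φ ρ = mk⇔
      (λ sat∀ ys → subst T (sat-renamed ys) (to (T-sat-foralls k _ ρ) sat∀ ys))
      (λ sat∀ → from (T-sat-foralls k _ ρ) λ ys → subst T (sym (sat-renamed ys)) (sat∀ ys))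
      where
      sat-renamed : ∀ ys → sat A F (ys Vec.++ ρ) (substFormula (λ i → var (i ↑ˡ _)) φ) ≡ sat A F ys φ
      sat-renamed ys = sat-substFormula (lookup-++ˡ ys ρ) φ

    sat-conjQF : ∀ {w} {φ ψ : Formula σ fa w} (p : IsQF φ) (q : IsΠ₁ ψ) (ρ : Env m w) →
                 sat A F ρ (proj₁ (conjQF p q)) ≡ sat A F ρ φ ∧ sat A F ρ ψ
    sat-conjQF p (qf q)                   ρ = refl
    sat-conjQF {φ = φ} p (univ {φ = ψ} q) ρ = begin
      all (λ d → sat A F (d ∷ ρ) (proj₁ (conjQF (substFormula-isQF _ p) q))) (allFin (suc m))
        ≡⟨ cong ListAction.and (map-cong (λ d → sat-conjQF _ q (d ∷ ρ)) (allFin (suc m))) ⟩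
      all (λ d → sat A F (d ∷ ρ) (weaken φ) ∧ sat A F (d ∷ ρ) ψ) (allFin (suc m))
        ≡⟨ cong ListAction.and (map-cong (λ d → cong (_∧ _) (sat-weaken d ρ φ)) (allFin (suc m))) ⟩
      all (λ d → sat A F ρ φ ∧ sat A F (d ∷ ρ) ψ) (allFin (suc m))
        ≡⟨ all-∧ˡ (sat A F ρ φ) (λ d → sat A F (d ∷ ρ) ψ) zero (tabulate suc) ⟩
      sat A F ρ φ ∧ all (λ d → sat A F (d ∷ ρ) ψ) (allFin (suc m))
        ∎
      where open ≡-Reasoning

    sat-conj : ∀ {w} {φ ψ : Formula σ fa w} (p : IsΠ₁ φ) (q : IsΠ₁ ψ) (ρ : Env m w) →
               sat A F ρ (proj₁ (conj p q)) ≡ sat A F ρ φ ∧ sat A F ρ ψ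
    sat-conj (qf p)                   q ρ = sat-conjQF p q ρ
    sat-conj {ψ = ψ} (univ {φ = φ} p) q ρ = begin
      all (λ d → sat A F (d ∷ ρ) (proj₁ (conj p (substFormula-isΠ₁ _ q)))) (allFin (suc m))
        ≡⟨ cong ListAction.and (map-cong (λ d → sat-conj p _ (d ∷ ρ)) (allFin (suc m))) ⟩
      all (λ d → sat A F (d ∷ ρ) φ ∧ sat A F (d ∷ ρ) (weaken ψ)) (allFin (suc m))
        ≡⟨ cong ListAction.and (map-cong (λ d → cong (_ ∧_) (sat-weaken d ρ ψ)) (allFin (suc m))) ⟩
      all (λ d → sat A F (d ∷ ρ) φ ∧ sat A F ρ ψ) (allFin (suc m))
        ≡⟨ all-∧ʳ (λ d → sat A F (d ∷ ρ) φ) (sat A F ρ ψ) zero (tabulate suc) ⟩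
      all (λ d → sat A F (d ∷ ρ) φ) (allFin (suc m)) ∧ sat A F ρ ψ
        ∎
      where open ≡-Reasoning

    sat-∧Π₁ : ∀ {w} (φ ψ : Π₁Formula w) (ρ : Env m w) →
              sat A F ρ (proj₁ (φ ∧Π₁ ψ)) ≡ sat A F ρ (proj₁ φ) ∧ sat A F ρ (proj₁ ψ)
    sat-∧Π₁ (_ , p) (_ , q) = sat-conj p q

    T-sat-∧Π₁ : ∀ {w} (φ ψ : Π₁Formula w) (ρ : Env m w) →
                T (sat A F ρ (proj₁ (φ ∧Π₁ ψ))) ⇔ (T (sat A F ρ (proj₁ φ)) × T (sat A F ρ (proj₁ ψ)))
    T-sat-∧Π₁ φ ψ ρ = ⇔-trans (mk⇔ (subst T sat≡) (subst T (sym sat≡))) T-∧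
      where sat≡ = sat-∧Π₁ φ ψ ρ

skolemArities : ∀ {σ fa v} → Formula σ fa v → List ℕ
skolemArities (rel _ _)    = []
skolemArities (eq _ _)     = []
skolemArities (le _ _)     = []
skolemArities (bit _ _)    = []
skolemArities (neg φ)      = skolemArities φ
skolemArities (and φ ψ)    = skolemArities φ ++ skolemArities ψ
skolemArities (or φ ψ)     = skolemArities φ ++ skolemArities ψ
skolemArities (ex {v} φ)   = v ∷ skolemArities φ
skolemArities (fall {v} φ) = v ∷ skolemArities φ

-- Every quantifier ∃x/∀x of φ, in a context of v variables, gets its own Skolem symbol of
-- arity v in fa⁺: it stands for the least witness of ∃, resp. the least counterexample of ∀.
module Skolemisation {σ : Vocab} {fa fa⁺ : List ℕ} (fa⊆fa⁺ : fa ⊆ fa⁺) where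

  mutual
    liftTerm : ∀ {v} → Term σ fa v → Term σ fa⁺ v
    liftTerm (var x)    = var x
    liftTerm (con c)    = con c
    liftTerm min        = min
    liftTerm (app f ts) = app (fa⊆fa⁺ f) (liftTerms ts)

    liftTerms : ∀ {v k} → Vec (Term σ fa v) k → Vec (Term σ fa⁺ v) k
    liftTerms []       = []
    liftTerms (t ∷ ts) = liftTerm t ∷ liftTerms ts

  instantiate : ∀ {v} → v ∈ fa⁺ → Formula σ fa⁺ (suc v) → Formula σ fa⁺ v
  instantiate g = substFormula λ { zero → app g (Vec.tabulate var) ; (suc i) → var i }

  skolemise : ∀ {v} (φ : Formula σ fa v) → skolemArities φ ⊆ fa⁺ → Formula σ fa⁺ v
  skolemise (rel R ts) e = rel R (liftTerms ts)
  skolemise (eq t u)   e = eq (liftTerm t) (liftTerm u)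
  skolemise (le t u)   e = le (liftTerm t) (liftTerm u)
  skolemise (bit t u)  e = bit (liftTerm t) (liftTerm u)
  skolemise (neg φ)    e = neg (skolemise φ e)
  skolemise (and φ ψ)  e = and (skolemise φ (e ∘ ∈-++⁺ˡ)) (skolemise ψ (e ∘ ∈-++⁺ʳ _))
  skolemise (or φ ψ)   e = or (skolemise φ (e ∘ ∈-++⁺ˡ)) (skolemise ψ (e ∘ ∈-++⁺ʳ _))
  skolemise (ex φ)     e = instantiate (e (here refl)) (skolemise φ (e ∘ there))
  skolemise (fall φ)   e = instantiate (e (here refl)) (skolemise φ (e ∘ there))

  skolemise-isQF : ∀ {v} (φ : Formula σ fa v) (e : skolemArities φ ⊆ fa⁺) → IsQF (skolemise φ e)
  skolemise-isQF (rel R ts) e = rel R _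
  skolemise-isQF (eq t u)   e = eq _ _
  skolemise-isQF (le t u)   e = le _ _
  skolemise-isQF (bit t u)  e = bit _ _
  skolemise-isQF (neg φ)    e = neg (skolemise-isQF φ e)
  skolemise-isQF (and φ ψ)  e = and (skolemise-isQF φ _) (skolemise-isQF ψ _)
  skolemise-isQF (or φ ψ)   e = or (skolemise-isQF φ _) (skolemise-isQF ψ _)
  skolemise-isQF (ex φ)     e = substFormula-isQF _ (skolemise-isQF φ _)
  skolemise-isQF (fall φ)   e = substFormula-isQF _ (skolemise-isQF φ _)

  -- In context z ∷ x̄ it says witnessCondition (g x̄) (λ y → b(y, x̄)) z.
  leastWitnessConstraint : ∀ {v} → v ∈ fa⁺ → Formula σ fa⁺ (suc v) → Formula σ fa⁺ (suc v)
  leastWitnessConstraint g b =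
    and (or (substFormula (λ { zero → gx̄ ; (suc i) → var (suc i) }) b) (and (eq gx̄ min) (neg b)))
        (or (le gx̄ (var zero)) (neg b))
    where gx̄ = app g (Vec.tabulate (var ∘ suc))

  leastWitnessConstraint-isQF : ∀ {v} (g : v ∈ fa⁺) {b} → IsQF b → IsQF (leastWitnessConstraint g b)
  leastWitnessConstraint-isQF g q =
    and (or (substFormula-isQF _ q) (and (eq _ _) (neg q))) (or (le _ _) (neg q))

  leastWitnessClosure : ∀ {v w} → v ∈ fa⁺ → (b : Formula σ fa⁺ (suc v)) → IsQF b → Π₁Formula w
  leastWitnessClosure g b q =
    closure (leastWitnessConstraint g b) , closure-isΠ₁ (qf (leastWitnessConstraint-isQF g q))

  skolemConstraint : ∀ {v w} (φ : Formula σ fa v) → skolemArities φ ⊆ fa⁺ → Π₁Formula w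
  skolemConstraint (rel _ _) e = eq min min , qf (eq min min)
  skolemConstraint (eq _ _)  e = eq min min , qf (eq min min)
  skolemConstraint (le _ _)  e = eq min min , qf (eq min min)
  skolemConstraint (bit _ _) e = eq min min , qf (eq min min)
  skolemConstraint (neg φ)   e = skolemConstraint φ e
  skolemConstraint (and φ ψ) e = skolemConstraint φ (e ∘ ∈-++⁺ˡ) ∧Π₁ skolemConstraint ψ (e ∘ ∈-++⁺ʳ _)
  skolemConstraint (or φ ψ)  e = skolemConstraint φ (e ∘ ∈-++⁺ˡ) ∧Π₁ skolemConstraint ψ (e ∘ ∈-++⁺ʳ _)
  skolemConstraint (ex φ)    e =
    leastWitnessClosure (e (here refl)) (skolemise φ (e ∘ there)) (skolemise-isQF φ _)
      ∧Π₁ skolemConstraint φ (e ∘ there)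
  skolemConstraint (fall φ)  e =
    leastWitnessClosure (e (here refl)) (neg (skolemise φ (e ∘ there))) (neg (skolemise-isQF φ _))
      ∧Π₁ skolemConstraint φ (e ∘ there)

  module _ {m} (A : Struct σ (suc m)) (F : FunAssign (suc m) fa) where

    canonicalSkolem : ∀ {v} (φ : Formula σ fa v) → FunAssign (suc m) (skolemArities φ)
    canonicalSkolem (rel _ _) = []
    canonicalSkolem (eq _ _)  = []
    canonicalSkolem (le _ _)  = []
    canonicalSkolem (bit _ _) = []
    canonicalSkolem (neg φ)   = canonicalSkolem φ
    canonicalSkolem (and φ ψ) = ++⁺ (canonicalSkolem φ) (canonicalSkolem ψ)
    canonicalSkolem (or φ ψ)  = ++⁺ (canonicalSkolem φ) (canonicalSkolem ψ)
    canonicalSkolem (ex φ)    = (λ xs → leastWitness λ y → sat A F (y ∷ xs) φ) ∷ canonicalSkolem φ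
    canonicalSkolem (fall φ)  = (λ xs → leastWitness λ y → not (sat A F (y ∷ xs) φ)) ∷ canonicalSkolem φ

    module _ (F⁺ : FunAssign (suc m) fa⁺) (F⁺↾F : RestrictsTo fa⊆fa⁺ F⁺ F) where

      IsCanonical : ∀ {v} (φ : Formula σ fa v) → skolemArities φ ⊆ fa⁺ → Set
      IsCanonical φ e = RestrictsTo e F⁺ (canonicalSkolem φ)

      mutual
        evalT-liftTerm : ∀ {v} (ρ : Env m v) t → evalT A F⁺ ρ (liftTerm t) ≡ evalT A F ρ t
        evalT-liftTerm ρ (var x)    = refl
        evalT-liftTerm ρ (con c)    = refl
        evalT-liftTerm ρ min        = refl
        evalT-liftTerm ρ (app f ts) = trans (cong (All.lookup F⁺ (fa⊆fa⁺ f)) (evalTs-liftTerms ρ ts)) (F⁺↾F f _)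

        evalTs-liftTerms : ∀ {v k} (ρ : Env m v) (ts : Vec (Term σ fa v) k) →
                           evalTs A F⁺ ρ (liftTerms ts) ≡ evalTs A F ρ ts
        evalTs-liftTerms ρ []       = refl
        evalTs-liftTerms ρ (t ∷ ts) = cong₂ _∷_ (evalT-liftTerm ρ t) (evalTs-liftTerms ρ ts)

      sat-instantiate : ∀ {v} (g : v ∈ fa⁺) b (ρ : Env m v) →
                        sat A F⁺ ρ (instantiate g b) ≡ sat A F⁺ (All.lookup F⁺ g ρ ∷ ρ) b
      sat-instantiate g b ρ = sat-substFormula A F⁺
        (λ { zero    → cong (All.lookup F⁺ g) (trans (evalTs-tabulate A F⁺ ρ var) (tabulate∘lookup ρ))
           ; (suc i) → refl })
        b

      sat-skolemise-instantiate :
        ∀ {v} (φ : Formula σ fa (suc v)) {e : v ∷ skolemArities φ ⊆ fa⁺} {f : Env m v → Fin (suc m)} →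
        RestrictsTo e F⁺ (f ∷ canonicalSkolem φ) →
        (∀ {e′ : skolemArities φ ⊆ fa⁺} → IsCanonical φ e′ → ∀ ρ → sat A F⁺ ρ (skolemise φ e′) ≡ sat A F ρ φ) →
        ∀ ρ → sat A F⁺ ρ (instantiate (e (here refl)) (skolemise φ (e ∘ there))) ≡ sat A F (f ρ ∷ ρ) φ
      sat-skolemise-instantiate φ {e} {f} c sat-skolemiseφ ρ = begin
        sat A F⁺ ρ (instantiate g (skolemise φ (e ∘ there)))
          ≡⟨ sat-instantiate g (skolemise φ (e ∘ there)) ρ ⟩
        sat A F⁺ (All.lookup F⁺ g ρ ∷ ρ) (skolemise φ (e ∘ there))
          ≡⟨ sat-skolemiseφ (proj₂ (to split c)) _ ⟩
        sat A F (All.lookup F⁺ g ρ ∷ ρ) φ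
          ≡⟨ cong (λ y → sat A F (y ∷ ρ) φ) (proj₁ (to split c) ρ) ⟩
        sat A F (f ρ ∷ ρ) φ
          ∎
        where
        open ≡-Reasoning
        g = e (here refl)
        split = RestrictsTo-∷ {e = e} F⁺ {f} {canonicalSkolem φ}

      sat-skolemise : ∀ {v} (φ : Formula σ fa v) {e : skolemArities φ ⊆ fa⁺} → IsCanonical φ e → ∀ ρ →
                      sat A F⁺ ρ (skolemise φ e) ≡ sat A F ρ φ
      sat-skolemise (rel R ts) c ρ = cong (All.lookup (relI A) R) (evalTs-liftTerms ρ ts)
      sat-skolemise (eq t u)   c ρ = cong₂ (λ x y → toℕ x ≡ᵇ toℕ y) (evalT-liftTerm ρ t) (evalT-liftTerm ρ u)
      sat-skolemise (le t u)   c ρ = cong₂ (λ x y → toℕ x ≤ᵇ toℕ y) (evalT-liftTerm ρ t) (evalT-liftTerm ρ u)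
      sat-skolemise (bit t u)  c ρ =
        cong₂ (λ x y → testBit (toℕ y) (toℕ x)) (evalT-liftTerm ρ t) (evalT-liftTerm ρ u)
      sat-skolemise (neg φ)    c ρ = cong not (sat-skolemise φ c ρ)
      sat-skolemise (and φ ψ)  c ρ =
        let (cφ , cψ) = to (RestrictsTo-++⁺ F⁺ (canonicalSkolem φ) (canonicalSkolem ψ)) c in
        cong₂ _∧_ (sat-skolemise φ cφ ρ) (sat-skolemise ψ cψ ρ)
      sat-skolemise (or φ ψ)   c ρ =
        let (cφ , cψ) = to (RestrictsTo-++⁺ F⁺ (canonicalSkolem φ) (canonicalSkolem ψ)) c in
        cong₂ _∨_ (sat-skolemise φ cφ ρ) (sat-skolemise ψ cψ ρ)
      sat-skolemise (ex φ)   c ρ =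
        trans (sat-skolemise-instantiate φ c (sat-skolemise φ) ρ) (leastWitness-any (λ y → sat A F (y ∷ ρ) φ))
      sat-skolemise (fall φ) c ρ =
        trans (sat-skolemise-instantiate φ c (sat-skolemise φ) ρ) (leastWitness-all (λ y → sat A F (y ∷ ρ) φ))

      sat-leastWitnessConstraint : ∀ {v} (g : v ∈ fa⁺) b z (xs : Env m v) →
        sat A F⁺ (z ∷ xs) (leastWitnessConstraint g b) ≡
        witnessCondition (All.lookup F⁺ g xs) (λ y → sat A F⁺ (y ∷ xs) b) z
      sat-leastWitnessConstraint g b z xs =
        cong₂ (λ bg gx̄ → (bg ∨ ((toℕ gx̄ ≡ᵇ 0) ∧ not Pz)) ∧ ((toℕ gx̄ ≤ᵇ toℕ z) ∨ not Pz))
              (sat-substFormula A F⁺ {ρ = All.lookup F⁺ g xs ∷ xs} (λ { zero → gx̄≡ ; (suc i) → refl }) b)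
              gx̄≡
        where
        Pz = sat A F⁺ (z ∷ xs) b
        gx̄≡ : All.lookup F⁺ g (evalTs A F⁺ (z ∷ xs) (Vec.tabulate (var ∘ suc))) ≡ All.lookup F⁺ g xs
        gx̄≡ = cong (All.lookup F⁺ g) (trans (evalTs-tabulate A F⁺ (z ∷ xs) (var ∘ suc)) (tabulate∘lookup xs))

      T-sat-leastWitnessClosure : ∀ {v w} (g : v ∈ fa⁺) b (q : IsQF b) (ρ : Env m w) →
        T (sat A F⁺ ρ (proj₁ (leastWitnessClosure g b q))) ⇔
        (∀ xs → All.lookup F⁺ g xs ≡ leastWitness (λ y → sat A F⁺ (y ∷ xs) b))
      T-sat-leastWitnessClosure g b q ρ = mk⇔
        (λ sat∀ xs → to (isLeastWitness⇔≡leastWitness _ _) (to (witnessCondition-isLeast _ _) λ z →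
          subst T (sat-leastWitnessConstraint g b z xs)
            (to (T-sat-closure A F⁺ (leastWitnessConstraint g b) ρ) sat∀ (z ∷ xs))))
        (λ g≡ → from (T-sat-closure A F⁺ (leastWitnessConstraint g b) ρ) λ { (z ∷ xs) →
          subst T (sym (sat-leastWitnessConstraint g b z xs))
            (from (witnessCondition-isLeast _ _) (from (isLeastWitness⇔≡leastWitness _ _) (g≡ xs)) z) })

      T-sat-conjunctionConstraint :
        ∀ {v w} (φ ψ : Formula σ fa v) (e : skolemArities φ ++ skolemArities ψ ⊆ fa⁺) (ρ : Env m w) →
        let Cφ = skolemConstraint φ (e ∘ ∈-++⁺ˡ)
            Cψ = skolemConstraint ψ (e ∘ ∈-++⁺ʳ _) in
        (T (sat A F⁺ ρ (proj₁ Cφ)) ⇔ IsCanonical φ (e ∘ ∈-++⁺ˡ)) →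
        (T (sat A F⁺ ρ (proj₁ Cψ)) ⇔ IsCanonical ψ (e ∘ ∈-++⁺ʳ _)) →
        T (sat A F⁺ ρ (proj₁ (Cφ ∧Π₁ Cψ))) ⇔ RestrictsTo e F⁺ (++⁺ (canonicalSkolem φ) (canonicalSkolem ψ))
      T-sat-conjunctionConstraint φ ψ e ρ IHφ IHψ =
        ⇔-trans (T-sat-∧Π₁ A F⁺ (skolemConstraint φ (e ∘ ∈-++⁺ˡ)) (skolemConstraint ψ (e ∘ ∈-++⁺ʳ _)) ρ)
          (⇔-trans (IHφ ×-⇔ IHψ) (⇔-sym (RestrictsTo-++⁺ F⁺ (canonicalSkolem φ) (canonicalSkolem ψ))))

      T-sat-quantifierConstraint :
        ∀ {v w} (φ : Formula σ fa (suc v)) (e : v ∷ skolemArities φ ⊆ fa⁺) b (q : IsQF b)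
          (P : Env m v → Fin (suc m) → Bool) (ρ : Env m w) →
        (IsCanonical φ (e ∘ there) → ∀ y xs → sat A F⁺ (y ∷ xs) b ≡ P xs y) →
        (T (sat A F⁺ ρ (proj₁ (skolemConstraint φ (e ∘ there)))) ⇔ IsCanonical φ (e ∘ there)) →
        T (sat A F⁺ ρ (proj₁ (leastWitnessClosure (e (here refl)) b q ∧Π₁ skolemConstraint φ (e ∘ there)))) ⇔
        RestrictsTo e F⁺ ((λ xs → leastWitness (P xs)) ∷ canonicalSkolem φ)
      T-sat-quantifierConstraint φ e b q P ρ b≡P IH = mk⇔ forward backward
        where
        g = e (here refl)
        C = leastWitnessClosure g b q ∧Π₁ skolemConstraint φ (e ∘ there)
        Canonical = RestrictsTo e F⁺ ((λ xs → leastWitness (P xs)) ∷ canonicalSkolem φ)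
        split-∷ = RestrictsTo-∷ {e = e} F⁺ {λ xs → leastWitness (P xs)} {canonicalSkolem φ}
        split-∧ = T-sat-∧Π₁ A F⁺ (leastWitnessClosure g b q) (skolemConstraint φ (e ∘ there)) ρ

        forward : T (sat A F⁺ ρ (proj₁ C)) → Canonical
        forward sat-C = from split-∷ (g≡ , cφ)
          where
          cφ = to IH (proj₂ (to split-∧ sat-C))
          g≡ : ∀ xs → All.lookup F⁺ g xs ≡ leastWitness (P xs)
          g≡ xs = trans (to (T-sat-leastWitnessClosure g b q ρ) (proj₁ (to split-∧ sat-C)) xs)
                        (leastWitness-cong (λ y → b≡P cφ y xs))

        backward : Canonical → T (sat A F⁺ ρ (proj₁ C))
        backward c = from split-∧ (from (T-sat-leastWitnessClosure g b q ρ) g≡ , from IH cφ)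
          where
          cφ = proj₂ (to split-∷ c)
          g≡ : ∀ xs → All.lookup F⁺ g xs ≡ leastWitness (λ y → sat A F⁺ (y ∷ xs) b)
          g≡ xs = trans (proj₁ (to split-∷ c) xs) (sym (leastWitness-cong (λ y → b≡P cφ y xs)))

      T-sat-skolemConstraint : ∀ {v w} (φ : Formula σ fa v) (e : skolemArities φ ⊆ fa⁺) (ρ : Env m w) →
                               T (sat A F⁺ ρ (proj₁ (skolemConstraint φ e))) ⇔ IsCanonical φ e
      T-sat-skolemConstraint (rel _ _) e ρ = mk⇔ (λ _ ()) (λ _ → tt)
      T-sat-skolemConstraint (eq _ _)  e ρ = mk⇔ (λ _ ()) (λ _ → tt)
      T-sat-skolemConstraint (le _ _)  e ρ = mk⇔ (λ _ ()) (λ _ → tt)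
      T-sat-skolemConstraint (bit _ _) e ρ = mk⇔ (λ _ ()) (λ _ → tt)
      T-sat-skolemConstraint (neg φ)   e ρ = T-sat-skolemConstraint φ e ρ
      T-sat-skolemConstraint (and φ ψ) e ρ =
        T-sat-conjunctionConstraint φ ψ e ρ (T-sat-skolemConstraint φ _ ρ) (T-sat-skolemConstraint ψ _ ρ)
      T-sat-skolemConstraint (or φ ψ)  e ρ =
        T-sat-conjunctionConstraint φ ψ e ρ (T-sat-skolemConstraint φ _ ρ) (T-sat-skolemConstraint ψ _ ρ)
      T-sat-skolemConstraint (ex φ)    e ρ =
        T-sat-quantifierConstraint φ e _ _ (λ xs y → sat A F (y ∷ xs) φ) ρ
          (λ c y xs → sat-skolemise φ c (y ∷ xs)) (T-sat-skolemConstraint φ (e ∘ there) ρ)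
      T-sat-skolemConstraint (fall φ)  e ρ =
        T-sat-quantifierConstraint φ e _ _ (λ xs y → not (sat A F (y ∷ xs) φ)) ρ
          (λ c y xs → cong not (sat-skolemise φ c (y ∷ xs))) (T-sat-skolemConstraint φ (e ∘ there) ρ)

module SkolemNormalForm {σ fa ℓ} (φ : Formula σ fa ℓ) where

  fa⁺ : List ℕ
  fa⁺ = fa ++ skolemArities φ

  functionSlots : fa ⊆ fa⁺
  functionSlots = ∈-++⁺ˡ

  skolemSlots : skolemArities φ ⊆ fa⁺
  skolemSlots = ∈-++⁺ʳ fa

  open Skolemisation {σ} {fa} {fa⁺} functionSlots

  matrix : Π₁Formula ℓ
  matrix = skolemise φ skolemSlots , qf (skolemise-isQF φ skolemSlots)

  constraints : Π₁Formula ℓ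
  constraints = skolemConstraint φ skolemSlots

  normalForm : Π₁Formula ℓ
  normalForm = matrix ∧Π₁ constraints

  module _ {m} (A : Struct σ (suc m)) (F : FunAssign (suc m) fa) (c : Env m ℓ) where

    F⁺↾F : ∀ G → RestrictsTo functionSlots (++⁺ F G) F
    F⁺↾F G {a} p = cong-app (lookup-++⁺ˡ F G p)

    isCanonical⇔≗ₐ : ∀ G → IsCanonical A F (++⁺ F G) (F⁺↾F G) φ skolemSlots ⇔ G ≗ₐ canonicalSkolem A F φ
    isCanonical⇔≗ₐ G = mk⇔ (λ r {a} p xs → trans (sym (cong-app (lookup-++⁺ʳ F G p) xs)) (r p xs))
                           (λ r {a} p xs → trans (cong-app (lookup-++⁺ʳ F G p) xs) (r p xs))

    sat-normalForm : ∀ G → sat A (++⁺ F G) c (proj₁ normalForm) ≡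
                           sat A (++⁺ F G) c (skolemise φ skolemSlots) ∧
                           sat A (++⁺ F G) c (proj₁ constraints)
    sat-normalForm G = sat-∧Π₁ A (++⁺ F G) matrix constraints c

    T-sat-constraints : ∀ G → T (sat A (++⁺ F G) c (proj₁ constraints)) ⇔
                              IsCanonical A F (++⁺ F G) (F⁺↾F G) φ skolemSlots
    T-sat-constraints G = T-sat-skolemConstraint A F (++⁺ F G) (F⁺↾F G) φ skolemSlots c

    sat-normalForm-canonical : ∀ G → G ≗ₐ canonicalSkolem A F φ →
                               sat A (++⁺ F G) c (proj₁ normalForm) ≡ sat A F c φ
    sat-normalForm-canonical G G≗ = begin
      sat A (++⁺ F G) c (proj₁ normalForm)
        ≡⟨ sat-normalForm G ⟩
      sat A (++⁺ F G) c (skolemise φ skolemSlots) ∧ sat A (++⁺ F G) c (proj₁ constraints)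
        ≡⟨ cong₂ _∧_ (sat-skolemise A F (++⁺ F G) (F⁺↾F G) φ canonical c)
                     (to T-≡ (from (T-sat-constraints G) canonical)) ⟩
      sat A F c φ ∧ true
        ≡⟨ ∧-identityʳ _ ⟩
      sat A F c φ
        ∎
      where
      open ≡-Reasoning
      canonical = from (isCanonical⇔≗ₐ G) G≗

    sat-normalForm-noncanonical : ∀ G → ¬ G ≗ₐ canonicalSkolem A F φ →
                                  sat A (++⁺ F G) c (proj₁ normalForm) ≡ false
    sat-normalForm-noncanonical G G≉ =
      trans (sat-normalForm G)
        (trans (cong (sat A (++⁺ F G) c (skolemise φ skolemSlots) ∧_) (¬T⇒≡false noncanonical)) (∧-zeroʳ _))
      where
      noncanonical = G≉ ∘ to (isCanonical⇔≗ₐ G) ∘ to (T-sat-constraints G)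

    sumBy-skolemExtensions : sumBy (λ G → indicator (sat A (++⁺ F G) c (proj₁ normalForm)))
                                   (allFunAssigns (suc m) (skolemArities φ)) ≡ indicator (sat A F c φ)
    sumBy-skolemExtensions =
      sumBy-class (OncePerClass-allFunAssigns (suc m) (skolemArities φ)) (canonicalSkolem A F φ) _ _
        (λ G G≗ → cong indicator (sat-normalForm-canonical G G≗))
        (λ G G≉ → cong indicator (sat-normalForm-noncanonical G G≉))

  count-normalForm : ∀ {m} (A : Struct σ (suc m)) → count (proj₁ normalForm) A ≡ count φ A
  count-normalForm {m} A = begin
    count (proj₁ normalForm) A
      ≡⟨ count-as-sumBy (proj₁ normalForm) A ⟩
    sumBy (λ H → sumBy (λ c → indicator (sat A H c (proj₁ normalForm))) tuples) (allFunAssigns (suc m) fa⁺)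
      ≡⟨ sumBy-allFunAssigns-++ (suc m) fa (skolemArities φ) _ ⟩
    sumBy (λ F → sumBy (λ G → sumBy (counted F G) tuples) extensions) assignments
      ≡⟨ sumBy-cong (λ F → sumBy-swap (counted F) extensions tuples) assignments ⟩
    sumBy (λ F → sumBy (λ c → sumBy (λ G → counted F G c) extensions) tuples) assignments
      ≡⟨ sumBy-cong (λ F → sumBy-cong (sumBy-skolemExtensions A F) tuples) assignments ⟩
    sumBy (λ F → sumBy (λ c → indicator (sat A F c φ)) tuples) assignments
      ≡⟨ count-as-sumBy φ A ⟨
    count φ A
      ∎
    where
    open ≡-Reasoning
    tuples      = allTuples (suc m) ℓ
    assignments = allFunAssigns (suc m) fa
    extensions  = allFunAssigns (suc m) (skolemArities φ)
    counted : FunAssign (suc m) fa → FunAssign (suc m) (skolemArities φ) → Env m ℓ → ℕ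
    counted F G c = indicator (sat A (++⁺ F G) c (proj₁ normalForm))

theorem4 : (f : List Bool → ℕ) → #FO f ⇔ #Π₁ f
theorem4 f = mk⇔ #FO⇒#Π₁ λ (σ , fa , ℓ , φ , _ , f≡count) → σ , fa , ℓ , φ , f≡count
  where
  #FO⇒#Π₁ : #FO f → #Π₁ f
  #FO⇒#Π₁ (σ , fa , ℓ , φ , f≡count) =
    σ , fa⁺ , ℓ , proj₁ normalForm , proj₂ normalForm ,
    λ m A → trans (f≡count m A) (sym (count-normalForm A))
    where open SkolemNormalForm φ
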